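{- For every integer $n\ge 4$ and every positive integer $m$, the neighbourhood corona $K_n\star K_m$ is Class $0$, i.e. $\pi(K_n\star K_m)=|V(K_n\star K_m)|=n+nm$.
   Context: For a simple graph $X=(V,E)$, a configuration is a function $\phi:V\to\mathbb{N}\cup\{0\}$; its size is $\sum_{u\in V}\phi(u)$. A pebbling step from a vertex $u$ to a neighbour $v$ removes two pebbles from $u$ and adds one pebble to $v$. For a target $r$, $\phi$ is $r$-solvable if some sequence of pebbling steps places at least one pebble on $r$. $\pi(X,r)$ is the minimum positive integer $m$ such that every configuration of size $m$ is $r$-solvable, and $\pi(X)=\max_{r\in V}\pi(X,r)$. $X$ is Class $0$ if $\pi(X)=|V(X)|$. The neighbourhood corona $A\star B$ is obtained from one copy of $A$ and $|V(A)|$ copies of $B$ by joining every neighbour (in $A$) of the $i$-th vertex of $A$ to every vertex of the $i$-th copy of $B$. -}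

module Defs where

open import Data.Nat using (ℕ; zero; suc; _+_; _*_; _∸_; _≤_; _<_)
open import Data.Fin using (Fin; splitAt; remQuot; _≟_)
open import Data.Sum using (_⊎_; inj₁; inj₂)
open import Data.Product using (_×_; _,_; Σ; ∃; ∃-syntax)
open import Data.List using (map; allFin)
open import Data.Nat.ListAction using (sum)
open import Relation.Nullary using (¬_; yes; no)
open import Relation.Binary.PropositionalEquality using (_≡_; _≢_)
open import Relation.Binary.Construct.Closure.ReflexiveTransitive using (Star)

record Graph : Set₁ where
  field
    N      : ℕ
    Adj    : Fin N → Fin N → Set
    irrefl : ∀ u → ¬ Adj u u
    sym    : ∀ {u v} → Adj u v → Adj v u
open Graph public

Config : Graph → Set
Config G = Fin (N G) → ℕ

size : (G : Graph) → Config G → ℕ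
size G φ = sum (map φ (allFin (N G)))

move : (G : Graph) → Config G → Fin (N G) → Fin (N G) → Config G
move G φ u v w with w ≟ u
... | yes _ = φ u ∸ 2
... | no _ with w ≟ v
...   | yes _ = suc (φ v)
...   | no _  = φ w

data Step (G : Graph) (φ ψ : Config G) : Set where
  step : (u v : Fin (N G)) → Adj G u v → 2 ≤ φ u →
         (∀ w → ψ w ≡ move G φ u v w) → Step G φ ψ

Solvable : (G : Graph) → Fin (N G) → Config G → Set
Solvable G r φ = ∃[ ψ ] (Star (Step G) φ ψ × 1 ≤ ψ r)

AllSolvable : (G : Graph) → Fin (N G) → ℕ → Set
AllSolvable G r m = ∀ (φ : Config G) → size G φ ≡ m → Solvable G r φ

IsRootedPebblingNumber : (G : Graph) → Fin (N G) → ℕ → Set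
IsRootedPebblingNumber G r p =
  1 ≤ p × AllSolvable G r p × (∀ k → 1 ≤ k → k < p → ¬ AllSolvable G r k)

IsPebblingNumber : Graph → ℕ → Set
IsPebblingNumber G p =
  (∃[ r ] IsRootedPebblingNumber G r p) ×
  (∀ r q → IsRootedPebblingNumber G r q → q ≤ p)

Class0 : Graph → Set
Class0 G = IsPebblingNumber G (N G)

K : ℕ → Graph
K n = record { N = n ; Adj = λ i j → i ≢ j ; irrefl = λ u p → p _≡_.refl
             ; sym = λ p q → p (Relation.Binary.PropositionalEquality.sym q) }

-- Neighbourhood corona A ⋆ B.  Vertex set: V(A) ⊎ (V(A) × V(B)),
-- encoded as Fin (nA + nA * nB) via splitAt and remQuot;
-- (i , b) is vertex b of the i-th copy of B.
CVert : ℕ → ℕ → Set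
CVert a b = Fin a ⊎ (Fin a × Fin b)

decode : ∀ a b → Fin (a + a * b) → CVert a b
decode a b x with splitAt a x
... | inj₁ i = inj₁ i
... | inj₂ y = inj₂ (remQuot b y)

data CAdj (A B : Graph) : CVert (N A) (N B) → CVert (N A) (N B) → Set where
  base  : ∀ {i j} → Adj A i j → CAdj A B (inj₁ i) (inj₁ j)
  copy  : ∀ {i b c} → Adj B b c → CAdj A B (inj₂ (i , b)) (inj₂ (i , c))
  join₁ : ∀ {i j b} → Adj A j i → CAdj A B (inj₁ j) (inj₂ (i , b))
  join₂ : ∀ {i j b} → Adj A j i → CAdj A B (inj₂ (i , b)) (inj₁ j)

CAdj-irrefl : (A B : Graph) → ∀ u → ¬ CAdj A B u u
CAdj-irrefl A B .(inj₁ _) (base p) = irrefl A _ p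
CAdj-irrefl A B .(inj₂ (_ , _)) (copy p) = irrefl B _ p

CAdj-sym : (A B : Graph) → ∀ {u v} → CAdj A B u v → CAdj A B v u
CAdj-sym A B (base p)  = base (sym A p)
CAdj-sym A B (copy p)  = copy (sym B p)
CAdj-sym A B (join₁ p) = join₂ p
CAdj-sym A B (join₂ p) = join₁ p

_⋆_ : Graph → Graph → Graph
A ⋆ B = record
  { N = N A + N A * N B
  ; Adj = λ x y → CAdj A B (decode (N A) (N B) x) (decode (N A) (N B) y)
  ; irrefl = λ u → CAdj-irrefl A B _
  ; sym = CAdj-sym A B }

-- If any three vertices of a graph have a common neighbour, then |V| pebbles always reach a
-- target r with φ(r) = 0.  Take a vertex d holding at least two pebbles, a common neighbour k₁
-- of d and r, and a common neighbour k₂ of d, r and k₁ (so r, k₁, k₂ are distinct).  Two pebbles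
-- gathered on a neighbour of r finish the job: on k₁ if d holds four pebbles, on k₁ or k₂ if it
-- is occupied, and on a common neighbour of d, d′, r if another vertex d′ holds two.  Otherwise
-- every vertex but d holds at most one pebble, d at most three, and r, k₁, k₂ none: fewer than
-- |V| pebbles in all.  Conversely, one pebble on each of fewer than |V| vertices other than r
-- admits no move at all.  In K_n ⋆ K_m a vertex k of K_n is adjacent to every vertex whose host
-- (the vertex of K_n it is, or whose copy of K_m contains it) differs from k, so for n ≥ 4 any
-- three vertices have a common neighbour.
module Submission where

open import Defs
open import Data.Nat using (ℕ; zero; suc; _+_; _*_; _∸_; _≤_; _<_; z≤n; s≤s; _≤?_)
open import Data.Nat.Properties
  using (≤-trans; ≤-pred; <⇒≱; ≮⇒≥; 1+n≰n; n≤0⇒n≡0; ∸-monoˡ-≤; +-suc; +-mono-≤;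
         +-0-monoid; +-commutativeSemigroup)
open import Algebra.Properties.Monoid.Sum +-0-monoid using (sum)
open import Algebra.Properties.CommutativeSemigroup +-commutativeSemigroup using (x∙yz≈y∙xz)
open import Data.Fin using (Fin; zero; suc; _≟_; _↑ˡ_; fromℕ<)
open import Data.Fin.Properties using (any?; injective⇒≤; splitAt-↑ˡ; toℕ<n)
open import Data.Vec.Functional as Vector using (updateAt)
open import Data.Vec.Functional.Properties using (updateAt-updates; updateAt-minimal)
open import Data.List using (List; []; _∷_; [_]; length; tabulate; lookup)
open import Data.List.Properties using (map-tabulate)
import Data.Nat.ListAction as ListAction
open import Data.List.Relation.Unary.All as All using (All; []; _∷_)
open import Data.List.Relation.Unary.Any as Any using (here; there; index)
open import Data.List.Relation.Unary.Any.Properties using (lookup-index)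
open import Data.List.Relation.Unary.Unique.Propositional using (Unique; []; _∷_)
open import Data.List.Membership.Propositional using (_∈_; _∉_)
open import Data.Product using (_×_; _,_; ∃-syntax)
open import Data.Sum using (inj₁; inj₂)
open import Function using (id; const)
open import Relation.Nullary using (¬_; yes; no; contradiction)
open import Relation.Nullary.Decidable using (¬?; _×-dec_; decidable-stable)
open import Relation.Binary.PropositionalEquality as ≡
  using (_≡_; _≢_; refl; trans; cong; subst; module ≡-Reasoning)
open import Relation.Binary.Construct.Closure.ReflexiveTransitive using (ε; _◅_)

sum-tabulate : ∀ {n} (f : Fin n → ℕ) → ListAction.sum (tabulate f) ≡ sum f
sum-tabulate {zero}  f = refl
sum-tabulate {suc n} f = cong (f zero +_) (sum-tabulate (λ w → f (suc w)))

size≡sum : (G : Graph) (φ : Config G) → size G φ ≡ sum φ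
size≡sum G φ = trans (cong ListAction.sum (map-tabulate id φ)) (sum-tabulate φ)

sum-updateAt : ∀ {n} (f : Fin n → ℕ) i (g : ℕ → ℕ) → f i + sum (updateAt f i g) ≡ g (f i) + sum f
sum-updateAt f zero    g = x∙yz≈y∙xz (f zero) (g (f zero)) _
sum-updateAt f (suc i) g = begin
  f (suc i) + (f zero + sum (updateAt f′ i g)) ≡⟨ x∙yz≈y∙xz (f (suc i)) (f zero) _ ⟩
  f zero + (f′ i + sum (updateAt f′ i g))      ≡⟨ cong (f zero +_) (sum-updateAt f′ i g) ⟩
  f zero + (g (f′ i) + sum f′)                  ≡⟨ x∙yz≈y∙xz (f zero) (g (f′ i)) _ ⟩
  g (f′ i) + (f zero + sum f′)                  ∎
  where
  open ≡-Reasoning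
  f′ : Fin _ → ℕ
  f′ w = f (suc w)

sum-≤1 : ∀ {n} {f : Fin n → ℕ} → (∀ w → f w ≤ 1) → sum f ≤ n
sum-≤1 {zero}  f≤1 = z≤n
sum-≤1 {suc n} f≤1 = +-mono-≤ (f≤1 zero) (sum-≤1 (λ w → f≤1 (suc w)))

updateAt-one-≤1 : ∀ {n} {f : Fin n → ℕ} i → (∀ w → w ≢ i → f w ≤ 1) →
                  ∀ w → updateAt f i (const 1) w ≤ 1
updateAt-one-≤1 {f = f} i f≤1 w with w ≟ i
... | yes refl = subst (_≤ 1) (≡.sym (updateAt-updates i f)) (s≤s z≤n)
... | no w≢i   = subst (_≤ 1) (≡.sym (updateAt-minimal w i f w≢i)) (f≤1 w w≢i)

updateAt-preserves-zeros : ∀ {n} {f : Fin n → ℕ} {i} {zs : List (Fin n)} {g : ℕ → ℕ} →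
                           All (i ≢_) zs → All (λ z → f z ≡ 0) zs →
                           All (λ z → updateAt f i g z ≡ 0) zs
updateAt-preserves-zeros {f = f} {i} i≢zs zeros =
  All.zipWith (λ (i≢z , fz≡0) → trans (updateAt-minimal _ i f (λ z≡i → i≢z (≡.sym z≡i))) fz≡0)
              (i≢zs , zeros)

sum-≤1-with-zeros : ∀ {n} (f : Fin n → ℕ) (zs : List (Fin n)) → Unique zs →
                    All (λ z → f z ≡ 0) zs → (∀ w → f w ≤ 1) → length zs + sum f ≤ n
sum-≤1-with-zeros f []       []             []           f≤1 = sum-≤1 f≤1
sum-≤1-with-zeros f (z ∷ zs) (z≢zs ∷ uniq) (fz≡0 ∷ zeros) f≤1 = begin
  suc (length zs + sum f)  ≡⟨ +-suc (length zs) (sum f) ⟨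
  length zs + suc (sum f)  ≡⟨ cong (length zs +_) filled ⟨
  length zs + sum f₁       ≤⟨ sum-≤1-with-zeros f₁ zs uniq
                                (updateAt-preserves-zeros z≢zs zeros)
                                (updateAt-one-≤1 z (λ w _ → f≤1 w)) ⟩
  _                        ∎
  where
  open Data.Nat.Properties.≤-Reasoning
  f₁ = updateAt f z (const 1)
  filled : sum f₁ ≡ suc (sum f)
  filled = subst (λ a → a + sum f₁ ≡ suc (sum f)) fz≡0 (sum-updateAt f z (const 1))

sum-≤1-but-one-with-zeros : ∀ {n} (f : Fin n → ℕ) (d : Fin n) (zs : List (Fin n)) {e} →
                            Unique zs → All (d ≢_) zs → All (λ z → f z ≡ 0) zs →
                            (∀ w → w ≢ d → f w ≤ 1) → f d ≤ suc e → length zs + sum f ≤ e + n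
sum-≤1-but-one-with-zeros {n} f d zs {e} uniq d≢zs zeros f≤1 fd≤ = ≤-pred (begin
  suc (length zs + sum f)      ≡⟨ +-suc (length zs) (sum f) ⟨
  length zs + suc (sum f)      ≡⟨ cong (length zs +_) (sum-updateAt f d (const 1)) ⟨
  length zs + (f d + sum f₁)   ≡⟨ x∙yz≈y∙xz (length zs) (f d) (sum f₁) ⟩
  f d + (length zs + sum f₁)   ≤⟨ +-mono-≤ fd≤ (sum-≤1-with-zeros f₁ zs uniq
                                    (updateAt-preserves-zeros d≢zs zeros)
                                    (updateAt-one-≤1 d f≤1)) ⟩
  suc e + n                    ∎)
  where
  open Data.Nat.Properties.≤-Reasoning
  f₁ = updateAt f d (const 1)

fresh : ∀ {n} (xs : List (Fin n)) → length xs < n → ∃[ k ] k ∉ xs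
fresh xs len<n with any? (λ k → ¬? (Any.any? (k ≟_) xs))
... | yes k∉xs = k∉xs
... | no none  =
  contradiction (injective⇒≤ {f = λ k → index (member k)} position-injective) (<⇒≱ len<n)
  where
  member : ∀ k → k ∈ xs
  member k = decidable-stable (Any.any? (k ≟_) xs) (λ k∉xs → none (k , k∉xs))
  position-injective : ∀ {i j} → index (member i) ≡ index (member j) → i ≡ j
  position-injective {i} {j} eq =
    trans (lookup-index (member i)) (trans (cong (lookup xs) eq) (≡.sym (lookup-index (member j))))

EveryTripleHasCommonNeighbour : Graph → Set
EveryTripleHasCommonNeighbour G = ∀ x y z → ∃[ k ] (Adj G x k × Adj G y k × Adj G z k)

module _ (G : Graph) where

  Adj⇒≢ : ∀ {u v} → Adj G u v → u ≢ v
  Adj⇒≢ {u} u~u refl = irrefl G u u~u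

  move-source : ∀ φ u v → move G φ u v u ≡ φ u ∸ 2
  move-source φ u v with u ≟ u
  ... | yes _   = refl
  ... | no u≢u  = contradiction refl u≢u

  move-target : ∀ φ {u v} → Adj G u v → move G φ u v v ≡ suc (φ v)
  move-target φ {u} {v} u~v with v ≟ u
  ... | yes refl = contradiction refl (Adj⇒≢ u~v)
  ... | no _ with v ≟ v
  ...   | yes _  = refl
  ...   | no v≢v = contradiction refl v≢v

  move-other : ∀ φ {u v w} → w ≢ u → w ≢ v → move G φ u v w ≡ φ w
  move-other φ {u} {v} {w} w≢u w≢v with w ≟ u
  ... | yes w≡u = contradiction w≡u w≢u
  ... | no _ with w ≟ v
  ...   | yes w≡v = contradiction w≡v w≢v
  ...   | no _    = refl

  pebble : ∀ {φ u v} → Adj G u v → 2 ≤ φ u → Step G φ (move G φ u v)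
  pebble u~v two = step _ _ u~v two (λ _ → refl)

  solvable-here : ∀ {r φ} → 1 ≤ φ r → Solvable G r φ
  solvable-here occupied = _ , ε , occupied

  solvable-after : ∀ {r φ ψ} → Step G φ ψ → Solvable G r ψ → Solvable G r φ
  solvable-after s (χ , steps , occupied) = χ , s ◅ steps , occupied

  solvable-from-neighbour : ∀ {r φ v} → Adj G v r → 2 ≤ φ v → Solvable G r φ
  solvable-from-neighbour {φ = φ} v~r two =
    solvable-after (pebble v~r two) (solvable-here (subst (1 ≤_) (≡.sym (move-target φ v~r)) (s≤s z≤n)))

  solvable-via : ∀ {r φ d k} → Adj G d k → Adj G k r → 2 ≤ φ d → 1 ≤ φ k → Solvable G r φ
  solvable-via {φ = φ} d~k k~r two one =
    solvable-after (pebble d~k two)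
      (solvable-from-neighbour k~r (subst (2 ≤_) (≡.sym (move-target φ d~k)) (s≤s one)))

  solvable-via-four : ∀ {r φ d k} → Adj G d k → Adj G k r → 4 ≤ φ d → Solvable G r φ
  solvable-via-four {φ = φ} {d} {k} d~k k~r four =
    solvable-after (pebble d~k (≤-trans (s≤s (s≤s z≤n)) four))
      (solvable-via d~k k~r (subst (2 ≤_) (≡.sym (move-source φ d k)) (∸-monoˡ-≤ 2 four))
                            (subst (1 ≤_) (≡.sym (move-target φ d~k)) (s≤s z≤n)))

  solvable-via-pair : ∀ {r φ d d′ k} → d′ ≢ d → Adj G d k → Adj G d′ k → Adj G k r →
                      2 ≤ φ d → 2 ≤ φ d′ → Solvable G r φ
  solvable-via-pair {φ = φ} d′≢d d~k d′~k k~r two two′ =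
    solvable-after (pebble d~k two)
      (solvable-via d′~k k~r (subst (2 ≤_) (≡.sym (move-other φ d′≢d (Adj⇒≢ d′~k))) two′)
                             (subst (1 ≤_) (≡.sym (move-target φ d~k)) (s≤s z≤n)))

  module _ (common : EveryTripleHasCommonNeighbour G) where

    solvable-with-heavy : ∀ {r φ d} → sum φ ≡ N G → φ r ≡ 0 → 2 ≤ φ d → Solvable G r φ
    solvable-with-heavy {r} {φ} {d} total r-empty heavy
      with k₁ , d~k₁ , r~k₁ , _ ← common d r r
      with k₂ , d~k₂ , r~k₂ , k₁~k₂ ← common d r k₁
      with 4 ≤? φ d | any? (λ d′ → ¬? (d′ ≟ d) ×-dec (2 ≤? φ d′)) | 1 ≤? φ k₁ | 1 ≤? φ k₂
    ... | yes four | _ | _ | _ = solvable-via-four d~k₁ (sym G r~k₁) four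
    ... | no _ | yes (d′ , d′≢d , heavy′) | _ | _ =
      let k , d~k , d′~k , r~k = common d d′ r
      in solvable-via-pair d′≢d d~k d′~k (sym G r~k) heavy heavy′
    ... | no _ | no _ | yes one | _ = solvable-via d~k₁ (sym G r~k₁) heavy one
    ... | no _ | no _ | no _ | yes one = solvable-via d~k₂ (sym G r~k₂) heavy one
    ... | no ¬four | no ¬heavy′ | no ¬one₁ | no ¬one₂ =
      contradiction (subst (λ s → 3 + s ≤ 2 + N G) total too-few) (λ p → 1+n≰n (≤-pred (≤-pred p)))
      where
      d≢r : d ≢ r
      d≢r refl = contradiction (subst (2 ≤_) r-empty heavy) λ ()
      light : ∀ w → w ≢ d → φ w ≤ 1
      light w w≢d = ≮⇒≥ (λ two → ¬heavy′ (w , w≢d , two))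
      too-few : 3 + sum φ ≤ 2 + N G
      too-few = sum-≤1-but-one-with-zeros φ d (r ∷ k₁ ∷ k₂ ∷ [])
        ((Adj⇒≢ r~k₁ ∷ Adj⇒≢ r~k₂ ∷ []) ∷ (Adj⇒≢ k₁~k₂ ∷ []) ∷ [] ∷ [])
        (d≢r ∷ Adj⇒≢ d~k₁ ∷ Adj⇒≢ d~k₂ ∷ [])
        (r-empty ∷ n≤0⇒n≡0 (≮⇒≥ ¬one₁) ∷ n≤0⇒n≡0 (≮⇒≥ ¬one₂) ∷ [])
        light (≮⇒≥ ¬four)

    solvable-of-sum : ∀ r φ → sum φ ≡ N G → Solvable G r φ
    solvable-of-sum r φ total with 1 ≤? φ r | any? (λ d → 2 ≤? φ d)
    ... | yes occupied | _ = solvable-here occupied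
    ... | no r-empty | yes (d , heavy) = solvable-with-heavy total (n≤0⇒n≡0 (≮⇒≥ r-empty)) heavy
    ... | no r-empty | no no-heavy =
      contradiction (subst (λ s → 1 + s ≤ N G) total
                       (sum-≤1-with-zeros φ [ r ] ([] ∷ []) (n≤0⇒n≡0 (≮⇒≥ r-empty) ∷ [])
                          (λ w → ≮⇒≥ (λ two → no-heavy (w , two)))))
                    1+n≰n

    solvable-of-size-N : ∀ r → AllSolvable G r (N G)
    solvable-of-size-N r φ size≡N = solvable-of-sum r φ (trans (≡.sym (size≡sum G φ)) size≡N)

unsolvable-if-sparse : ∀ (G : Graph) {r φ} → φ r ≡ 0 → (∀ w → φ w ≤ 1) → ¬ Solvable G r φ
unsolvable-if-sparse G r-empty sparse (_ , ε , occupied) =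
  contradiction (subst (1 ≤_) r-empty occupied) λ ()
unsolvable-if-sparse G r-empty sparse (_ , step u _ _ two _ ◅ _ , _) =
  contradiction (≤-trans two (sparse u)) λ { (s≤s ()) }

ones : ∀ {n} → ℕ → Fin n → ℕ
ones zero    _       = 0
ones (suc k) zero    = 1
ones (suc k) (suc w) = ones k w

ones-≤1 : ∀ {n} k (w : Fin n) → ones k w ≤ 1
ones-≤1 zero    _       = z≤n
ones-≤1 (suc k) zero    = s≤s z≤n
ones-≤1 (suc k) (suc w) = ones-≤1 k w

sum-ones : ∀ {n} k → k ≤ n → sum (ones {n} k) ≡ k
sum-ones {zero}  zero    _       = refl
sum-ones {suc n} zero    _       = sum-ones {n} zero z≤n
sum-ones {suc n} (suc k) (s≤s k≤n) = cong suc (sum-ones k k≤n)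

sparse-config : ∀ {n} (r : Fin n) k → k < n → ∃[ f ] ((∀ w → f w ≤ 1) × f r ≡ 0 × sum f ≡ k)
sparse-config zero k (s≤s k≤n) =
  0 Vector.∷ ones k , (λ { zero → z≤n ; (suc w) → ones-≤1 k w }) , refl , sum-ones k k≤n
sparse-config {n} (suc r) zero _ = ones 0 , ones-≤1 0 , refl , sum-ones {n} 0 z≤n
sparse-config (suc r) (suc k) (s≤s k<n) with f , f≤1 , fr≡0 , Σf ← sparse-config r k k<n =
  1 Vector.∷ f , (λ { zero → s≤s z≤n ; (suc w) → f≤1 w }) , fr≡0 , cong suc Σf

rooted-lower-bound : ∀ (G : Graph) r k → k < N G → ¬ AllSolvable G r k
rooted-lower-bound G r k k<N all with f , f≤1 , fr≡0 , Σf ← sparse-config r k k<N =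
  unsolvable-if-sparse G fr≡0 f≤1 (all f (trans (size≡sum G f) Σf))

solvable-of-size-N⇒Class0 : ∀ (G : Graph) → (∀ r → AllSolvable G r (N G)) → Fin (N G) → Class0 G
solvable-of-size-N⇒Class0 G solvable r₀ = (r₀ , rooted r₀) , at-most-N
  where
  1≤N : 1 ≤ N G
  1≤N = ≤-trans (s≤s z≤n) (toℕ<n r₀)
  rooted : ∀ r → IsRootedPebblingNumber G r (N G)
  rooted r = 1≤N , solvable r , λ k _ → rooted-lower-bound G r k
  at-most-N : ∀ r q → IsRootedPebblingNumber G r q → q ≤ N G
  at-most-N r q (_ , _ , minimal) = ≮⇒≥ (λ N<q → minimal (N G) 1≤N N<q (solvable r))

K-commonNeighbours : ∀ {n} → 4 ≤ n → EveryTripleHasCommonNeighbour (K n)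
K-commonNeighbours 3<n x y z with k , k∉ ← fresh (x ∷ y ∷ z ∷ []) 3<n =
  k , (λ x≡k → k∉ (here (≡.sym x≡k))) , (λ y≡k → k∉ (there (here (≡.sym y≡k))))
    , (λ z≡k → k∉ (there (there (here (≡.sym z≡k)))))

host : ∀ {a b} → CVert a b → Fin a
host (inj₁ i)       = i
host (inj₂ (i , _)) = i

CAdj-host : ∀ (A B : Graph) {c k} → Adj A (host c) k → CAdj A B c (inj₁ k)
CAdj-host A B {inj₁ _} h~k = base h~k
CAdj-host A B {inj₂ _} h~k = join₂ (sym A h~k)

decode-↑ˡ : ∀ a b (k : Fin a) → decode a b (k ↑ˡ a * b) ≡ inj₁ k
decode-↑ˡ a b k rewrite splitAt-↑ˡ a k (a * b) = refl

⋆-commonNeighbours : ∀ {A B : Graph} → EveryTripleHasCommonNeighbour A → EveryTripleHasCommonNeighbour (A ⋆ B)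
⋆-commonNeighbours {A} {B} common x y z =
  let k , x~k , y~k , z~k = common (host (dec x)) (host (dec y)) (host (dec z))
  in k ↑ˡ N A * N B , lift x~k , lift y~k , lift z~k
  where
  dec = decode (N A) (N B)
  lift : ∀ {v k} → Adj A (host (dec v)) k → Adj (A ⋆ B) v (k ↑ˡ N A * N B)
  lift {k = k} h~k = subst (CAdj A B (dec _)) (≡.sym (decode-↑ˡ (N A) (N B) k)) (CAdj-host A B h~k)

mainTheorem10 : (n m : ℕ) → 4 ≤ n → 1 ≤ m → Class0 (K n ⋆ K m)
mainTheorem10 n m 4≤n _ =
  solvable-of-size-N⇒Class0 (K n ⋆ K m)
    (solvable-of-size-N _ (⋆-commonNeighbours (K-commonNeighbours 4≤n)))
    (fromℕ< 4≤n ↑ˡ n * m)
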